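{- Every vertex identifying code of the infinite hexagonal grid $H$ has density at least $2/5$.
   Context: The infinite hexagonal grid $H$ is the infinite 3-regular planar graph formed by the vertices and edges of the tiling of the plane by regular hexagons. For a vertex $v$, $N[v]$ denotes the closed neighborhood of $v$ ($v$ together with its neighbors). A (vertex) identifying code is a set $\mathcal{D}\subseteq V(H)$ such that for any two distinct vertices $u,v\in V(H)$ the sets $N[u]\cap\mathcal{D}$ and $N[v]\cap\mathcal{D}$ are nonempty and distinct. The density of $\mathcal{D}$ is $\limsup_{h\to\infty}|\mathcal{D}\cap V_h|/|V_h|$, where $V_h$ is the set of vertices at distance at most $h$ from a fixed vertex $v$. -}

module Defs where

open import Data.Bool using (Bool; true; false; _∧_; _∨_)
open import Data.Nat as ℕ using (ℕ; zero; suc; _%_; _≡ᵇ_)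
open import Data.Integer using (ℤ; +_; _+_; _-_; ∣_∣)
import Data.Integer as ℤ
open import Data.List using (List; []; _∷_; map; concatMap; upTo; filterᵇ; length)
open import Data.Bool.ListAction using (any)
open import Data.List.Membership.Propositional using (_∈_)
open import Data.Product using (_×_; _,_; ∃)
open import Data.Sum using (_⊎_)
open import Relation.Nullary using (¬_; does)
open import Relation.Binary.PropositionalEquality using (_≡_)

-- Vertices of the infinite hexagonal grid H, in the standard "brick wall"
-- coordinates: (x , y) is adjacent to (x+1 , y), (x-1 , y), and to
-- (x , y+1) if x+y is even, resp. (x , y-1) if x+y is odd.
-- This graph is isomorphic to the hexagonal tiling graph.
V : Set
V = ℤ × ℤ

evenℤ : ℤ → Bool
evenℤ z = ∣ z ∣ % 2 ≡ᵇ 0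

nbrs : V → List V
nbrs (x , y) =
  (x + + 1 , y) ∷ (x - + 1 , y) ∷
  (if′ evenℤ (x + y) then (x , y + + 1) else (x , y - + 1)) ∷ []
  where
  if′_then_else_ : {A : Set} → Bool → A → A → A
  if′ true then a else b = a
  if′ false then a else b = b

Adj : V → V → Set
Adj u w = w ∈ nbrs u

N[_] : V → V → Set
N[ u ] w = u ≡ w ⊎ Adj u w

InD : (V → Bool) → V → Set
InD D w = D w ≡ true

NcapD : (V → Bool) → V → V → Set
NcapD D u w = N[ u ] w × InD D w

_≐_ : (V → Set) → (V → Set) → Set
P ≐ Q = ∀ w → (P w → Q w) × (Q w → P w)

IdentifyingCode : (V → Bool) → Set
IdentifyingCode D =
  (∀ u → ∃ λ w → NcapD D u w) ×
  (∀ u v → ¬ u ≡ v → ¬ (NcapD D u ≐ NcapD D v))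

_==V_ : V → V → Bool
(a , b) ==V (c , d) = does (a ℤ.≟ c) ∧ does (b ℤ.≟ d)

-- reach h u w = true  iff  dist_H(u , w) ≤ h
reach : ℕ → V → V → Bool
reach zero u w = u ==V w
reach (suc h) u w = reach h u w ∨ any (λ n → reach h n w) (nbrs u)

-- the box [x-h, x+h] × [y-h, y+h]; it contains every vertex at distance ≤ h
-- from (x , y), since each edge changes each coordinate by at most 1
range : ℤ → ℕ → List ℤ
range c h = map (λ i → (c - + h) + + i) (upTo (suc (h ℕ.+ h)))

box : V → ℕ → List V
box (x , y) h = concatMap (λ a → map (λ b → (a , b)) (range y h)) (range x h)

ballSize : V → ℕ → ℕ
ballSize v h = length (filterᵇ (reach h v) (box v h))

codeInBall : (V → Bool) → V → ℕ → ℕ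
codeInBall D v h = length (filterᵇ (λ w → reach h v w ∧ D w) (box v h))

-- density (a limsup of |D ∩ V_h| / |V_h|) is at least 2/5, unfolded:
-- for every ε = 1/(k+1) and every N there is h ≥ N with
-- |D ∩ V_h| / |V_h| ≥ 2/5 - 1/(k+1), i.e.
-- 2 (k+1) |V_h| ≤ 5 (k+1) |D ∩ V_h| + 5 |V_h|.
DensityAtLeast2/5 : (V → Bool) → V → Set
DensityAtLeast2/5 D v =
  ∀ (k N : ℕ) → ∃ λ h → N ℕ.≤ h ×
    (2 ℕ.* suc k ℕ.* ballSize v h
      ℕ.≤ 5 ℕ.* suc k ℕ.* codeInBall D v h ℕ.+ 5 ℕ.* ballSize v h)

module Submission where

open import Defs
open import Data.Bool using (Bool)

-- Write B(h) = |V_h| and C(h) = |D ∩ V_h| for the balls around v.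
-- Discharging (module Tokens): each vertex u hands out two tokens (c , l)
-- with c ∈ N[u] ∩ D.  If |N[u] ∩ D| ≥ 2 they are two code neighbours labelled
-- by their direction from u; if N[u] ∩ D = {c} they are (c , direction) and
-- (c , nothing).  The label recovers u from c, and since D is identifying at
-- most one vertex has N[u] ∩ D = {c}; so all tokens are distinct, and those of
-- V_g lie in (D ∩ V_(g+1)) × (5 labels).  A pigeonhole principle for lists
-- (module ListCounting) yields  B(g)·2 ≤ C(g+1)·5.
-- Geometry (module Grid): V_h contains v and lies in the box of side 2h+1 of
-- Defs, so 1 ≤ B(h) ≤ (2h+1)².
-- Limsup (module Growth): if C/B ≥ 2/5 - 1/(k+1) failed at every h ≥ N, the
-- counting bound would make B grow by the factor 2(k+1)/(2k-3) per step; by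
-- Bernoulli's inequality this beats the quadratic bound.  So the density
-- bound holds at arbitrarily large h, which is DensityAtLeast2/5.

module ListCounting where

  open import Data.Nat using (zero; suc; _+_; _*_; _≤_)
  open import Data.Fin using (Fin; zero; suc)
  open import Data.Fin.Properties using (injective⇒≤)
  open import Data.List using (List; []; _∷_; _++_; map; length; lookup; concatMap; cartesianProductWith; cartesianProduct)
  open import Data.List.Properties using (length-++; length-map)
  open import Data.List.Membership.Propositional using (_∈_)
  open import Data.List.Membership.Propositional.Properties using (∈-lookup)
  open import Data.List.Relation.Binary.Subset.Propositional using (_⊆_)
  open import Data.List.Relation.Unary.All as All using ()
  open import Data.List.Relation.Unary.AllPairs using (_∷_)
  open import Data.List.Relation.Unary.Any using (index)
  open import Data.List.Relation.Unary.Any.Properties using (lookup-index)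
  open import Data.List.Relation.Unary.Unique.Propositional using (Unique)
  open import Data.Product using (_,_)
  open import Data.Empty using (⊥-elim)
  open import Relation.Binary.PropositionalEquality

  module _ {A : Set} where

    lookup-injective : ∀ (xs : List A) → Unique xs → ∀ i j → lookup xs i ≡ lookup xs j → i ≡ j
    lookup-injective (x ∷ xs) _ zero zero _ = refl
    lookup-injective (x ∷ xs) (x∉xs ∷ _) zero (suc j) x≡xsⱼ = ⊥-elim (All.lookup x∉xs (∈-lookup j) x≡xsⱼ)
    lookup-injective (x ∷ xs) (x∉xs ∷ _) (suc i) zero xsᵢ≡x = ⊥-elim (All.lookup x∉xs (∈-lookup i) (sym xsᵢ≡x))
    lookup-injective (x ∷ xs) (_ ∷ unique) (suc i) (suc j) eq = cong suc (lookup-injective xs unique i j eq)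

    unique-⊆⇒length-≤ : ∀ {xs ys : List A} → Unique xs → xs ⊆ ys → length xs ≤ length ys
    unique-⊆⇒length-≤ {xs} {ys} unique xs⊆ys = injective⇒≤ {f = position} position-injective
      where
      position : Fin (length xs) → Fin (length ys)
      position i = index (xs⊆ys (∈-lookup i))
      position-injective : ∀ {i j} → position i ≡ position j → i ≡ j
      position-injective {i} {j} eq = lookup-injective xs unique i j (begin
          lookup xs i
        ≡⟨ lookup-index (xs⊆ys (∈-lookup i)) ⟩
          lookup ys (position i)
        ≡⟨ cong (lookup ys) eq ⟩
          lookup ys (position j)
        ≡⟨ lookup-index (xs⊆ys (∈-lookup j)) ⟨
          lookup xs j
        ∎)
        where open ≡-Reasoning

  module _ {A B C : Set} where

    length-cartesianProductWith : ∀ (f : A → B → C) xs ys →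
      length (cartesianProductWith f xs ys) ≡ length xs * length ys
    length-cartesianProductWith f [] ys = refl
    length-cartesianProductWith f (x ∷ xs) ys = begin
        length (map (f x) ys ++ cartesianProductWith f xs ys)
      ≡⟨ length-++ (map (f x) ys) ⟩
        length (map (f x) ys) + length (cartesianProductWith f xs ys)
      ≡⟨ cong₂ _+_ (length-map (f x) ys) (length-cartesianProductWith f xs ys) ⟩
        length ys + length xs * length ys
      ∎
      where open ≡-Reasoning

  module _ {A B : Set} where

    -- The cartesian product written as a `concatMap`, as `box` is defined.
    concatMap≡cartesianProduct : ∀ (xs : List A) (ys : List B) →
      concatMap (λ a → map (λ b → (a , b)) ys) xs ≡ cartesianProduct xs ys
    concatMap≡cartesianProduct [] ys = refl
    concatMap≡cartesianProduct (x ∷ xs) ys = cong (map (x ,_) ys ++_) (concatMap≡cartesianProduct xs ys)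

module Growth where

  open import Data.Nat
  open import Data.Nat.Properties
  open import Data.Nat.Tactic.RingSolver using (solve-∀)
  open import Data.Product using (∃; _×_; _,_; proj₁; proj₂)
  open import Data.Sum using (_⊎_; inj₁; inj₂; [_,_]′)
  open import Data.Empty using (⊥-elim)
  open import Function using (id)
  open import Relation.Nullary using (¬_; yes; no)
  open import Relation.Unary using (Decidable)
  open import Relation.Binary.PropositionalEquality

  -- Bernoulli's inequality with denominators cleared:
  -- (1 + d/b)ⁿ ≥ 1 + d·n/b.
  bernoulli : ∀ b d n → b ^ n * (b + d * n) ≤ b * (b + d) ^ n
  bernoulli b d zero = ≤-reflexive (base b d)
    where
    base : ∀ b d → 1 * (b + d * 0) ≡ b * 1
    base = solve-∀
  bernoulli b d (suc n) = begin
      b * b ^ n * (b + d * suc n)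
    ≤⟨ m≤m+n _ (d * d * n * b ^ n) ⟩
      b * b ^ n * (b + d * suc n) + d * d * n * b ^ n
    ≡⟨ expand b d n (b ^ n) ⟩
      b ^ n * (b + d * n) * (b + d)
    ≤⟨ *-monoˡ-≤ (b + d) (bernoulli b d n) ⟩
      b * (b + d) ^ n * (b + d)
    ≡⟨ regroup b d ((b + d) ^ n) ⟩
      b * ((b + d) * (b + d) ^ n)
    ∎
    where
    open ≤-Reasoning
    expand : ∀ b d n p → b * p * (b + d * suc n) + d * d * n * p ≡ p * (b + d * n) * (b + d)
    expand = solve-∀
    regroup : ∀ b d q → b * q * (b + d) ≡ b * ((b + d) * q)
    regroup = solve-∀

  -- Taking n = b in Bernoulli: (1 + d/b)ᵇ ≥ 1 + d ≥ 2 as soon as d ≥ 1.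
  doubling : ∀ b d .{{_ : NonZero b}} → 1 ≤ d → 2 * b ^ b ≤ (b + d) ^ b
  doubling b d 1≤d = *-cancelˡ-≤ b (begin
      b * (2 * b ^ b)
    ≡⟨ regroup b (b ^ b) ⟩
      b ^ b * (b + 1 * b)
    ≤⟨ *-monoʳ-≤ (b ^ b) (+-monoʳ-≤ b (*-monoˡ-≤ b 1≤d)) ⟩
      b ^ b * (b + d * b)
    ≤⟨ bernoulli b d b ⟩
      b * (b + d) ^ b
    ∎)
    where
    open ≤-Reasoning
    regroup : ∀ b p → b * (2 * p) ≡ p * (b + 1 * b)
    regroup = solve-∀

  doubling-iterated : ∀ b d s .{{_ : NonZero b}} → 1 ≤ d → 2 ^ s * b ^ (b * s) ≤ (b + d) ^ (b * s)
  doubling-iterated b d zero 1≤d rewrite *-zeroʳ b = ≤-refl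
  doubling-iterated b d (suc s) 1≤d rewrite *-suc b s = begin
      2 * 2 ^ s * b ^ (b + b * s)
    ≡⟨ cong (2 * 2 ^ s *_) (^-distribˡ-+-* b b (b * s)) ⟩
      2 * 2 ^ s * (b ^ b * b ^ (b * s))
    ≡⟨ regroup 2 (2 ^ s) (b ^ b) (b ^ (b * s)) ⟩
      (2 * b ^ b) * (2 ^ s * b ^ (b * s))
    ≤⟨ *-mono-≤ (doubling b d 1≤d) (doubling-iterated b d s 1≤d) ⟩
      (b + d) ^ b * (b + d) ^ (b * s)
    ≡⟨ ^-distribˡ-+-* (b + d) b (b * s) ⟨
      (b + d) ^ (b + b * s)
    ∎
    where
    open ≤-Reasoning
    regroup : ∀ x y z w → x * y * (z * w) ≡ (x * z) * (y * w)
    regroup = solve-∀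

  n<2^n : ∀ n → n < 2 ^ n
  n<2^n zero = s≤s z≤n
  n<2^n (suc n) = begin-strict
      suc n
    ≤⟨ n<2^n n ⟩
      2 ^ n
    <⟨ m<m+n (2 ^ n) (m^n>0 2 n) ⟩
      2 ^ n + 2 ^ n
    ≡⟨ cong (2 ^ n +_) (+-identityʳ (2 ^ n)) ⟨
      2 ^ (suc n)
    ∎
    where open ≤-Reasoning

  square-<-^ : ∀ {m} n → m < 2 ^ n → m * m < 2 ^ (n + n)
  square-<-^ {m} n m<2^n =
    subst (m * m <_) (sym (^-distribˡ-+-* 2 n n)) (*-mono-< m<2^n m<2^n)

  boxArea : ℕ → ℕ
  boxArea h = suc (h + h) * suc (h + h)

  quadratic<exponential : ∀ b N → ∃ λ s → boxArea (b * s + N) < 2 ^ s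
  quadratic<exponential b N = s , square-<-^ (j + j) side<2^2j
    where
    j s : ℕ
    j = suc (8 * b + 2 * N)
    s = (j + j) + (j + j)
    side≤j*j : suc ((b * s + N) + (b * s + N)) ≤ j * j
    side≤j*j = ≤-trans (m≤m+n _ _) (≤-reflexive (identity b N))
      where
      identity : ∀ b N → let j = suc (8 * b + 2 * N) ; s = (j + j) + (j + j) in
        suc ((b * s + N) + (b * s + N)) + (2 * N + 1) * (8 * b + 2 * N) ≡ j * j
      identity = solve-∀
    side<2^2j : suc ((b * s + N) + (b * s + N)) < 2 ^ (j + j)
    side<2^2j = ≤-<-trans side≤j*j (square-<-^ j (n<2^n j))

  module Escape (B : ℕ → ℕ) {P : ℕ → Set} (P? : Decidable P) (b d : ℕ)
                (grows : ∀ h → ¬ P (suc h) → (b + d) * B h ≤ b * B (suc h)) where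

    iterate : ∀ N t → (∃ λ h → N ≤ h × P h) ⊎ ((b + d) ^ t * B N ≤ b ^ t * B (t + N))
    iterate N zero = inj₂ ≤-refl
    iterate N (suc t) with iterate N t | P? (suc (t + N))
    ... | inj₁ found | _ = inj₁ found
    ... | inj₂ _ | yes p = inj₁ (suc (t + N) , ≤-trans (m≤n+m N t) (n≤1+n _) , p)
    ... | inj₂ grown | no ¬p = inj₂ (begin
        (b + d) * (b + d) ^ t * B N
      ≡⟨ *-assoc (b + d) _ (B N) ⟩
        (b + d) * ((b + d) ^ t * B N)
      ≤⟨ *-monoʳ-≤ (b + d) grown ⟩
        (b + d) * (b ^ t * B (t + N))
      ≡⟨ x[yz]≡y[xz] (b + d) (b ^ t) (B (t + N)) ⟩
        b ^ t * ((b + d) * B (t + N))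
      ≤⟨ *-monoʳ-≤ (b ^ t) (grows (t + N) ¬p) ⟩
        b ^ t * (b * B (suc (t + N)))
      ≡⟨ x[yz]≡y[xz] (b ^ t) b (B (suc (t + N))) ⟩
        b * (b ^ t * B (suc (t + N)))
      ≡⟨ *-assoc b (b ^ t) _ ⟨
        b * b ^ t * B (suc (t + N))
      ∎)
      where
      open ≤-Reasoning
      x[yz]≡y[xz] : ∀ x y z → x * (y * z) ≡ y * (x * z)
      x[yz]≡y[xz] = solve-∀

    grown⇒large : .{{_ : NonZero b}} → 1 ≤ d → ∀ N s → 1 ≤ B N →
      (b + d) ^ (b * s) * B N ≤ b ^ (b * s) * B (b * s + N) → 2 ^ s ≤ B (b * s + N)
    grown⇒large 1≤d N s positive grown = *-cancelʳ-≤ (2 ^ s) _ (b ^ (b * s)) {{m^n≢0 b (b * s)}} (begin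
        2 ^ s * b ^ (b * s)
      ≤⟨ doubling-iterated b d s 1≤d ⟩
        (b + d) ^ (b * s)
      ≤⟨ m≤m*n _ (B N) {{>-nonZero positive}} ⟩
        (b + d) ^ (b * s) * B N
      ≤⟨ grown ⟩
        b ^ (b * s) * B (b * s + N)
      ≡⟨ *-comm (b ^ (b * s)) _ ⟩
        B (b * s + N) * b ^ (b * s)
      ∎)
      where open ≤-Reasoning

    escape : .{{_ : NonZero b}} → 1 ≤ d → (∀ h → 1 ≤ B h) → (∀ h → B h ≤ boxArea h) →
             ∀ N → ∃ λ h → N ≤ h × P h
    escape 1≤d positive quadratic N = [ id , impossible ]′ (iterate N (b * s))
      where
      s : ℕ
      s = proj₁ (quadratic<exponential b N)
      impossible : (b + d) ^ (b * s) * B N ≤ b ^ (b * s) * B (b * s + N) → ∃ λ h → N ≤ h × P h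
      impossible grown = ⊥-elim (<⇒≱ (proj₂ (quadratic<exponential b N))
        (≤-trans (grown⇒large 1≤d N s (positive N) grown) (quadratic (b * s + N))))

  -- The density inequality "C/B ≥ 2/5 - 1/(k+1)", with denominators cleared.
  DensityBound : ℕ → ℕ → ℕ → Set
  DensityBound k B C = 2 * suc k * B ≤ 5 * suc k * C + 5 * B

  -- When the local counting bound B(g)·2 ≤ C(g+1)·5 holds, a failure of the
  -- density bound at g+1 forces B to grow by the factor (b+5)/b = 2(k+1)/(2k-3).
  failure⇒growth : ∀ b k B B′ C′ → b + 5 ≡ 2 * suc k → B * 2 ≤ C′ * 5 →
                   ¬ DensityBound k B′ C′ → (b + 5) * B ≤ b * B′
  failure⇒growth b k B B′ C′ b+5≡2[1+k] counting failure =
    +-cancelʳ-≤ (5 * B′) _ _ (<⇒≤ (begin-strict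
        (b + 5) * B + 5 * B′
      ≡⟨ cong (λ a → a * B + 5 * B′) b+5≡2[1+k] ⟩
        2 * suc k * B + 5 * B′
      ≡⟨ cong (_+ 5 * B′) (regroup (suc k) B) ⟩
        suc k * (B * 2) + 5 * B′
      ≤⟨ +-monoˡ-≤ (5 * B′) (*-monoʳ-≤ (suc k) counting) ⟩
        suc k * (C′ * 5) + 5 * B′
      ≡⟨ cong (_+ 5 * B′) (regroup′ (suc k) C′) ⟩
        5 * suc k * C′ + 5 * B′
      <⟨ ≰⇒> failure ⟩
        2 * suc k * B′
      ≡⟨ cong (_* B′) b+5≡2[1+k] ⟨
        (b + 5) * B′
      ≡⟨ *-distribʳ-+ B′ b 5 ⟩
        b * B′ + 5 * B′
      ∎))
    where
    open ≤-Reasoning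
    regroup : ∀ m x → 2 * m * x ≡ m * (x * 2)
    regroup = solve-∀
    regroup′ : ∀ m x → m * (x * 5) ≡ 5 * m * x
    regroup′ = solve-∀

  -- For k ≤ 1 the bound says C/B ≥ 2/5 - 1/(k+1) ≤ 0 and holds trivially.
  density-bound-small-k : ∀ k B C → 2 * suc k ≤ 5 → DensityBound k B C
  density-bound-small-k k B C 2[1+k]≤5 =
    ≤-trans (*-monoˡ-≤ B 2[1+k]≤5) (m≤n+m (5 * B) (5 * suc k * C))

  density-from-counting : (B C : ℕ → ℕ) → (∀ g → B g * 2 ≤ C (suc g) * 5) →
    (∀ h → 1 ≤ B h) → (∀ h → B h ≤ boxArea h) →
    ∀ k N → ∃ λ h → N ≤ h × DensityBound k (B h) (C h)
  density-from-counting B C counting positive quadratic zero N =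
    N , ≤-refl , density-bound-small-k 0 (B N) (C N) (s≤s (s≤s z≤n))
  density-from-counting B C counting positive quadratic (suc zero) N =
    N , ≤-refl , density-bound-small-k 1 (B N) (C N) (s≤s (s≤s (s≤s (s≤s z≤n))))
  density-from-counting B C counting positive quadratic k@(suc (suc k′)) N =
    Escape.escape B (λ h → 2 * suc k * B h ≤? 5 * suc k * C h + 5 * B h)
      b 5 (λ g → failure⇒growth b k (B g) (B (suc g)) (C (suc g)) (b+5≡2[1+k] k′) (counting g))
      (s≤s z≤n) positive quadratic N
    where
    b : ℕ
    b = suc (k′ + k′)
    b+5≡2[1+k] : ∀ k′ → suc (k′ + k′) + 5 ≡ 2 * suc (suc (suc k′))
    b+5≡2[1+k] = solve-∀

module Grid where

  open ListCounting
  open Growth using (boxArea)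
  open import Data.Bool using (Bool; true; false; not; T)
  open import Data.Bool.Properties using (T-∨; not-involutive)
  open import Data.Unit using (tt)
  open import Data.Nat as ℕ using (ℕ; zero; suc; _%_; _≡ᵇ_)
  import Data.Nat.Properties as ℕ
  open import Data.Integer as ℤ using (ℤ; +_; -[1+_]; _+_; _-_)
  import Data.Integer.Properties as ℤ
  open import Data.Integer.Tactic.RingSolver using (solve-∀)
  open import Data.Fin using (Fin; zero; suc)
  open import Data.List using (List; []; _∷_; upTo; map; length; cartesianProduct)
  import Data.List.Properties as List
  open import Data.List.Membership.Propositional using (_∈_; find; lose)
  open import Data.List.Membership.Propositional.Properties using (∈-map⁺; ∈-upTo⁺; ∈-cartesianProduct⁺; ∈-filter⁺; ∈-length)
  open import Data.List.Relation.Unary.Any using (here; there)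
  open import Data.List.Relation.Unary.Any.Properties using (any⁺; any⁻)
  open import Data.List.Relation.Unary.Unique.Propositional using (Unique)
  import Data.List.Relation.Unary.Unique.Propositional.Properties as Unique
  open import Data.Product using (_×_; _,_; proj₁; proj₂; ∃)
  open import Data.Sum using (_⊎_; inj₁; inj₂)
  open import Function using (_∘_)
  open import Function.Bundles using (Equivalence)
  open import Relation.Nullary using (yes; no)
  open import Relation.Nullary.Decidable using (T?)
  open import Relation.Binary.PropositionalEquality

  -- Parity flips under successor, on ℕ and on ℤ; this makes the vertical
  -- neighbour map an involution.
  even-suc : ∀ n → (suc n % 2 ≡ᵇ 0) ≡ not (n % 2 ≡ᵇ 0)
  even-suc zero = refl
  even-suc (suc zero) = refl
  even-suc (suc (suc n)) = even-suc n

  evenℤ-suc : ∀ z → evenℤ (z + + 1) ≡ not (evenℤ z)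
  evenℤ-suc (+ n) rewrite ℕ.+-comm n 1 = even-suc n
  evenℤ-suc -[1+ zero ] = refl
  evenℤ-suc -[1+ suc n ] = trans (sym (not-involutive _)) (cong not (sym (even-suc (suc n))))

  evenℤ-pred : ∀ z → evenℤ (z - + 1) ≡ not (evenℤ z)
  evenℤ-pred z = begin
      evenℤ (z - + 1)
    ≡⟨ not-involutive _ ⟨
      not (not (evenℤ (z - + 1)))
    ≡⟨ cong not (evenℤ-suc (z - + 1)) ⟨
      not (evenℤ (z - + 1 + + 1))
    ≡⟨ cong (not ∘ evenℤ) (cancel z) ⟩
      not (evenℤ z)
    ∎
    where
    open ≡-Reasoning
    cancel : ∀ z → z - + 1 + + 1 ≡ z
    cancel = solve-∀

  shift : Bool → ℤ → ℤ
  shift true y = y + + 1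
  shift false y = y - + 1

  vertical : V → V
  vertical (x , y) = (x , shift (evenℤ (x + y)) y)

  nbrs≡ : ∀ x y → nbrs (x , y) ≡ (x + + 1 , y) ∷ (x - + 1 , y) ∷ vertical (x , y) ∷ []
  nbrs≡ x y with evenℤ (x + y)
  ... | true = refl
  ... | false = refl

  shift-flips : ∀ x y b → evenℤ (x + y) ≡ b → evenℤ (x + shift b y) ≡ not b
  shift-flips x y true parity = begin
      evenℤ (x + (y + + 1))
    ≡⟨ cong evenℤ (ℤ.+-assoc x y (+ 1)) ⟨
      evenℤ (x + y + + 1)
    ≡⟨ evenℤ-suc (x + y) ⟩
      not (evenℤ (x + y))
    ≡⟨ cong not parity ⟩
      false
    ∎
    where open ≡-Reasoning
  shift-flips x y false parity = begin
      evenℤ (x + (y - + 1))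
    ≡⟨ cong evenℤ (reassoc x y) ⟩
      evenℤ (x + y - + 1)
    ≡⟨ evenℤ-pred (x + y) ⟩
      not (evenℤ (x + y))
    ≡⟨ cong not parity ⟩
      true
    ∎
    where
    open ≡-Reasoning
    reassoc : ∀ x y → x + (y - + 1) ≡ x + y - + 1
    reassoc = solve-∀

  shift-not-shift : ∀ b y → shift (not b) (shift b y) ≡ y
  shift-not-shift true y = cancel y
    where
    cancel : ∀ y → y + + 1 - + 1 ≡ y
    cancel = solve-∀
  shift-not-shift false y = cancel y
    where
    cancel : ∀ y → y - + 1 + + 1 ≡ y
    cancel = solve-∀

  vertical-involutive : ∀ u → vertical (vertical u) ≡ u
  vertical-involutive (x , y) = cong (x ,_) (begin
      shift (evenℤ (x + shift b y)) (shift b y)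
    ≡⟨ cong (λ c → shift c (shift b y)) (shift-flips x y b refl) ⟩
      shift (not b) (shift b y)
    ≡⟨ shift-not-shift b y ⟩
      y
    ∎)
    where
    open ≡-Reasoning
    b : Bool
    b = evenℤ (x + y)

  step : V → Fin 4 → V
  step u zero = u
  step (x , y) (suc zero) = (x + + 1 , y)
  step (x , y) (suc (suc zero)) = (x - + 1 , y)
  step u (suc (suc (suc zero))) = vertical u

  back : V → Fin 4 → V
  back u zero = u
  back (x , y) (suc zero) = (x - + 1 , y)
  back (x , y) (suc (suc zero)) = (x + + 1 , y)
  back u (suc (suc (suc zero))) = vertical u

  back-step : ∀ u s → back (step u s) s ≡ u
  back-step u zero = refl
  back-step (x , y) (suc zero) = cong (_, y) (cancel x)
    where
    cancel : ∀ x → x + + 1 - + 1 ≡ x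
    cancel = solve-∀
  back-step (x , y) (suc (suc zero)) = cong (_, y) (cancel x)
    where
    cancel : ∀ x → x - + 1 + + 1 ≡ x
    cancel = solve-∀
  back-step u (suc (suc (suc zero))) = vertical-involutive u

  adjacent : ∀ x y {w} → w ∈ (x + + 1 , y) ∷ (x - + 1 , y) ∷ vertical (x , y) ∷ [] → Adj (x , y) w
  adjacent x y {w} = subst (w ∈_) (sym (nbrs≡ x y))

  step∈N : ∀ u s → N[ u ] (step u s)
  step∈N u zero = inj₁ refl
  step∈N (x , y) (suc zero) = inj₂ (adjacent x y (here refl))
  step∈N (x , y) (suc (suc zero)) = inj₂ (adjacent x y (there (here refl)))
  step∈N (x , y) (suc (suc (suc zero))) = inj₂ (adjacent x y (there (there (here refl))))

  N⇒step : ∀ u w → N[ u ] w → ∃ λ s → step u s ≡ w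
  N⇒step u w (inj₁ refl) = zero , refl
  N⇒step (x , y) w (inj₂ w∈nbrs) with subst (w ∈_) (nbrs≡ x y) w∈nbrs
  ... | here refl = suc zero , refl
  ... | there (here refl) = suc (suc zero) , refl
  ... | there (there (here refl)) = suc (suc (suc zero)) , refl

  ==V-sound : ∀ u w → T (u ==V w) → u ≡ w
  ==V-sound (a , b) (c , d) eq with a ℤ.≟ c | b ℤ.≟ d
  ==V-sound (a , b) (a , b) eq | yes refl | yes refl = refl
  ==V-sound (a , b) (c , d) () | yes _ | no _
  ==V-sound (a , b) (c , d) () | no _ | _

  ==V-refl : ∀ u → T (u ==V u)
  ==V-refl (a , b) with a ℤ.≟ a | b ℤ.≟ b
  ... | yes _ | yes _ = tt
  ... | no a≢a | _ = a≢a refl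
  ... | yes _ | no b≢b = b≢b refl

  reach-stay : ∀ h v w → T (reach h v w) → T (reach (suc h) v w)
  reach-stay h v w near = Equivalence.from (T-∨ {reach h v w}) (inj₁ near)

  reach-via : ∀ h v n w → Adj v n → T (reach h n w) → T (reach (suc h) v w)
  reach-via h v n w v~n near =
    Equivalence.from (T-∨ {reach h v w}) (inj₂ (any⁺ (λ m → reach h m w) (lose v~n near)))

  reach-cases : ∀ h v w → T (reach (suc h) v w) →
                T (reach h v w) ⊎ ∃ λ n → Adj v n × T (reach h n w)
  reach-cases h v w far with Equivalence.to (T-∨ {reach h v w}) far
  ... | inj₁ near = inj₁ near
  ... | inj₂ via = inj₂ (find (any⁻ (λ m → reach h m w) (nbrs v) via))

  reach-refl : ∀ h u → T (reach h u u)
  reach-refl zero u = ==V-refl u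
  reach-refl (suc h) u = reach-stay h u u (reach-refl h u)

  reach-step : ∀ g v u w → T (reach g v u) → Adj u w → T (reach (suc g) v w)
  reach-step zero v u w v=u u~w with ==V-sound v u v=u
  ... | refl = reach-via zero u w w u~w (==V-refl w)
  reach-step (suc g) v u w v~u u~w with reach-cases g v u v~u
  ... | inj₁ near = reach-stay (suc g) v w (reach-step g v u w near u~w)
  ... | inj₂ (n , v~n , n~u) = reach-via (suc g) v n w v~n (reach-step g n u w n~u u~w)

  reach-N : ∀ g v u w → T (reach g v u) → N[ u ] w → T (reach (suc g) v w)
  reach-N g v u w v~u (inj₁ refl) = reach-stay g v u v~u
  reach-N g v u w v~u (inj₂ u~w) = reach-step g v u w v~u u~w

  InRange : ℤ → ℕ → ℤ → Set
  InRange c h z = ∃ λ i → i ℕ.< suc (h ℕ.+ h) × z ≡ (c - + h) + + i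

  InBox : V → ℕ → V → Set
  InBox (x , y) h (a , b) = InRange x h a × InRange y h b

  range-centre : ∀ c → InRange c 0 c
  range-centre c = 0 , ℕ.s≤s ℕ.z≤n , shift0 c
    where
    shift0 : ∀ c → c ≡ (c - + 0) + + 0
    shift0 = solve-∀

  range-widen : ∀ c h z → InRange c h z → InRange c (suc h) z
  range-widen c h z (i , i<2h+1 , refl) = suc i , bound , reindex c (+ h) (+ i)
    where
    bound : suc i ℕ.< suc (suc h ℕ.+ suc h)
    bound rewrite ℕ.+-suc h h = ℕ.m<n⇒m<1+n (ℕ.s≤s i<2h+1)
    reindex : ∀ c H I → (c - H) + I ≡ (c - (+ 1 + H)) + (+ 1 + I)
    reindex = solve-∀

  range-shift : ∀ b c h z → InRange (shift b c) h z → InRange c (suc h) z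
  range-shift true c h z (i , i<2h+1 , refl) = suc (suc i) , bound , reindex c (+ h) (+ i)
    where
    bound : suc (suc i) ℕ.< suc (suc h ℕ.+ suc h)
    bound rewrite ℕ.+-suc h h = ℕ.s≤s (ℕ.s≤s i<2h+1)
    reindex : ∀ c H I → ((c + + 1) - H) + I ≡ (c - (+ 1 + H)) + (+ 2 + I)
    reindex = solve-∀
  range-shift false c h z (i , i<2h+1 , refl) = i , bound , reindex c (+ h) (+ i)
    where
    bound : i ℕ.< suc (suc h ℕ.+ suc h)
    bound rewrite ℕ.+-suc h h = ℕ.m<n⇒m<1+n (ℕ.m<n⇒m<1+n i<2h+1)
    reindex : ∀ c H I → ((c - + 1) - H) + I ≡ (c - (+ 1 + H)) + I
    reindex = solve-∀

  box-neighbour : ∀ u n h w → Adj u n → InBox n h w → InBox u (suc h) w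
  box-neighbour (x , y) n h (a , b) u~n (ia , ib) with subst (n ∈_) (nbrs≡ x y) u~n
  ... | here refl = range-shift true x h a ia , range-widen y h b ib
  ... | there (here refl) = range-shift false x h a ia , range-widen y h b ib
  ... | there (there (here refl)) = range-widen x h a ia , range-shift (evenℤ (x + y)) y h b ib

  -- Each edge changes each coordinate by at most one, so V_h lies in the box.
  reach-box : ∀ h v w → T (reach h v w) → InBox v h w
  reach-box zero v w v=w with ==V-sound v w v=w
  ... | refl = range-centre (proj₁ v) , range-centre (proj₂ v)
  reach-box (suc h) v@(x , y) w@(a , b) v~w with reach-cases h v w v~w
  ... | inj₁ near = let (ia , ib) = reach-box h v w near in range-widen x h a ia , range-widen y h b ib
  ... | inj₂ (n , v~n , n~w) = box-neighbour v n h w v~n (reach-box h n w n~w)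

  box≡ : ∀ x y h → box (x , y) h ≡ cartesianProduct (range x h) (range y h)
  box≡ x y h = concatMap≡cartesianProduct (range x h) (range y h)

  InBox⇒∈box : ∀ v h w → InBox v h w → w ∈ box v h
  InBox⇒∈box (x , y) h (a , b) (ia , ib) =
    subst ((a , b) ∈_) (sym (box≡ x y h)) (∈-cartesianProduct⁺ (∈range x ia) (∈range y ib))
    where
    ∈range : ∀ c {z} → InRange c h z → z ∈ range c h
    ∈range c (i , i<2h+1 , refl) = ∈-map⁺ (λ i → (c - + h) + + i) (∈-upTo⁺ i<2h+1)

  +-cancelˡ : ∀ a {m n} → a + m ≡ a + n → m ≡ n
  +-cancelˡ a {m} {n} eq = begin
      m            ≡⟨ cancel a m ⟩
      ℤ.- a + (a + m) ≡⟨ cong (λ k → ℤ.- a + k) eq ⟩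
      ℤ.- a + (a + n) ≡⟨ cancel a n ⟨
      n            ∎
    where
    open ≡-Reasoning
    cancel : ∀ a m → m ≡ ℤ.- a + (a + m)
    cancel = solve-∀

  box-unique : ∀ v h → Unique (box v h)
  box-unique (x , y) h = subst Unique (sym (box≡ x y h))
    (Unique.cartesianProduct⁺ (range-unique x) (range-unique y))
    where
    range-unique : ∀ c → Unique (range c h)
    range-unique c = Unique.map⁺ (λ eq → ℤ.+-injective (+-cancelˡ (c - + h) eq)) (Unique.upTo⁺ _)

  length-box : ∀ v h → length (box v h) ≡ boxArea h
  length-box (x , y) h = begin
      length (box (x , y) h)
    ≡⟨ cong length (box≡ x y h) ⟩
      length (cartesianProduct (range x h) (range y h))
    ≡⟨ length-cartesianProductWith _,_ (range x h) (range y h) ⟩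
      length (range x h) ℕ.* length (range y h)
    ≡⟨ cong₂ ℕ._*_ (length-range x) (length-range y) ⟩
      suc (h ℕ.+ h) ℕ.* suc (h ℕ.+ h)
    ∎
    where
    open ≡-Reasoning
    length-range : ∀ c → length (range c h) ≡ suc (h ℕ.+ h)
    length-range c = trans (List.length-map _ (upTo (suc (h ℕ.+ h)))) (List.length-upTo (suc (h ℕ.+ h)))

  ballSize-positive : ∀ v h → 1 ℕ.≤ ballSize v h
  ballSize-positive v h = ∈-length (∈-filter⁺ (T? ∘ reach h v)
    (InBox⇒∈box v h v (reach-box h v v (reach-refl h v))) (reach-refl h v))

  ballSize-quadratic : ∀ v h → ballSize v h ℕ.≤ boxArea h
  ballSize-quadratic v h =
    ℕ.≤-trans (List.length-filter (T? ∘ reach h v) (box v h)) (ℕ.≤-reflexive (length-box v h))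

module Tokens where

  open ListCounting
  open Grid
  open import Data.Bool using (Bool; T; _∧_)
  open import Data.Bool.Properties using (T-≡; T-∧)
  open import Data.Nat as ℕ using (suc)
  open import Data.Nat.Properties using (module ≤-Reasoning)
  open import Data.Integer as ℤ using ()
  open import Data.Fin using (Fin; zero; suc)
  open import Data.List using (List; []; _∷_; filterᵇ; allFin; map; length; cartesianProduct; cartesianProductWith)
  open import Data.List.Membership.Propositional using (_∈_)
  open import Data.List.Membership.Propositional.Properties
    using (∈-filter⁺; ∈-filter⁻; ∈-allFin; ∈-map⁺; ∈-cartesianProduct⁺; ∈-cartesianProductWith⁻)
  open import Data.List.Relation.Unary.Any using (here; there)
  open import Data.List.Relation.Unary.All using (_∷_)
  open import Data.List.Relation.Unary.AllPairs using (_∷_)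
  open import Data.List.Relation.Unary.Unique.Propositional using (Unique)
  import Data.List.Relation.Unary.Unique.Propositional.Properties as Unique
  open import Data.Maybe using (Maybe; just; nothing)
  open import Data.Maybe.Properties using (just-injective)
  open import Data.Product using (_×_; _,_; proj₁; proj₂; ∃)
  open import Data.Product.Properties using (≡-dec)
  open import Data.Sum using (_⊎_; inj₁; inj₂)
  open import Data.Empty using (⊥-elim)
  open import Function.Bundles using (Equivalence)
  open import Relation.Nullary using (¬_; Dec; yes; no)
  open import Relation.Nullary.Decidable using (T?)
  open import Relation.Binary.PropositionalEquality

  module _ {A : Set} where

    -- Two labelled picks from a non-empty list (the default d only serves the
    -- empty list): the first two entries labelled by themselves, or, if there
    -- is a single entry a, the picks (a , just a) and (a , nothing).
    choose : A → List A → Fin 2 → A × Maybe A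
    choose d [] _ = d , just d
    choose d (a ∷ []) zero = a , just a
    choose d (a ∷ []) (suc zero) = a , nothing
    choose d (a ∷ b ∷ _) zero = a , just a
    choose d (a ∷ b ∷ _) (suc zero) = b , just b

    choose-∈ : ∀ d xs i → ¬ xs ≡ [] → proj₁ (choose d xs i) ∈ xs
    choose-∈ d [] i xs≢[] = ⊥-elim (xs≢[] refl)
    choose-∈ d (a ∷ []) zero _ = here refl
    choose-∈ d (a ∷ []) (suc zero) _ = here refl
    choose-∈ d (a ∷ b ∷ _) zero _ = here refl
    choose-∈ d (a ∷ b ∷ _) (suc zero) _ = there (here refl)

    choose-label : ∀ d xs i → let (a , l) = choose d xs i in l ≡ just a ⊎ (l ≡ nothing × xs ≡ a ∷ [])
    choose-label d [] i = inj₁ refl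
    choose-label d (a ∷ []) zero = inj₁ refl
    choose-label d (a ∷ []) (suc zero) = inj₂ (refl , refl)
    choose-label d (a ∷ b ∷ _) zero = inj₁ refl
    choose-label d (a ∷ b ∷ _) (suc zero) = inj₁ refl

    choose-labels-differ : ∀ d xs → Unique xs → ¬ xs ≡ [] →
      ∀ i j → proj₂ (choose d xs i) ≡ proj₂ (choose d xs j) → i ≡ j
    choose-labels-differ d xs _ _ zero zero _ = refl
    choose-labels-differ d xs _ _ (suc zero) (suc zero) _ = refl
    choose-labels-differ d [] _ xs≢[] _ _ _ = ⊥-elim (xs≢[] refl)
    choose-labels-differ d (a ∷ []) _ _ zero (suc zero) ()
    choose-labels-differ d (a ∷ []) _ _ (suc zero) zero ()
    choose-labels-differ d (a ∷ b ∷ _) ((a≢b ∷ _) ∷ _) _ zero (suc zero) eq = ⊥-elim (a≢b (just-injective eq))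
    choose-labels-differ d (a ∷ b ∷ _) ((a≢b ∷ _) ∷ _) _ (suc zero) zero eq = ⊥-elim (a≢b (sym (just-injective eq)))

  _≟V_ : (u w : V) → Dec (u ≡ w)
  _≟V_ = ≡-dec ℤ._≟_ ℤ._≟_

  module Code (D : V → Bool) where

    codeDirs : V → List (Fin 4)
    codeDirs u = filterᵇ (λ s → D (step u s)) (allFin 4)

    codeDirs-unique : ∀ u → Unique (codeDirs u)
    codeDirs-unique u = Unique.filter⁺ (λ s → T? (D (step u s))) (Unique.allFin⁺ 4)

    codeDirs-∈ : ∀ u {s} → s ∈ codeDirs u → InD D (step u s)
    codeDirs-∈ u s∈ = Equivalence.to T-≡ (proj₂ (∈-filter⁻ (λ s → T? (D (step u s))) s∈))

    ∈-codeDirs : ∀ u s → InD D (step u s) → s ∈ codeDirs u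
    ∈-codeDirs u s inD = ∈-filter⁺ (λ s → T? (D (step u s))) (∈-allFin s) (Equivalence.from T-≡ inD)

    NcapD⇒codeDir : ∀ u w → NcapD D u w → ∃ λ s → s ∈ codeDirs u × step u s ≡ w
    NcapD⇒codeDir u w (w∈N , inD) with N⇒step u w w∈N
    ... | s , refl = s , ∈-codeDirs u s inD , refl

    singleton-code : ∀ u s → codeDirs u ≡ s ∷ [] → ∀ w → (NcapD D u w → step u s ≡ w) × (step u s ≡ w → NcapD D u w)
    singleton-code u s only-s w = to , from
      where
      to : NcapD D u w → step u s ≡ w
      to w∈ with NcapD⇒codeDir u w w∈
      ... | t , t∈ , refl with subst (t ∈_) only-s t∈
      ... | here refl = refl
      from : step u s ≡ w → NcapD D u w
      from refl = step∈N u s , codeDirs-∈ u (subst (s ∈_) (sym only-s) (here refl))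

    module _ (identifying : IdentifyingCode D) where

      codeDirs-nonempty : ∀ u → ¬ codeDirs u ≡ []
      codeDirs-nonempty u empty with proj₁ identifying u
      ... | w , w∈ with NcapD⇒codeDir u w w∈
      ... | s , s∈ , _ with subst (s ∈_) empty s∈
      ... | ()

      -- Distinct vertices have distinct code neighbourhoods (constructively,
      -- using that vertex equality is decidable).
      separates : ∀ u u′ → NcapD D u ≐ NcapD D u′ → u ≡ u′
      separates u u′ same with u ≟V u′
      ... | yes u≡u′ = u≡u′
      ... | no u≢u′ = ⊥-elim (proj₂ identifying u u′ u≢u′ same)

      -- The i-th token of u: a code vertex of N[u] together with a label, namely
      -- the direction from u to it, or `nothing` if it is u's only code neighbour.
      token : V → Fin 2 → V × Maybe (Fin 4)
      token u i = step u (proj₁ pick) , proj₂ pick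
        where
        pick : Fin 4 × Maybe (Fin 4)
        pick = choose zero (codeDirs u) i

      token-∈ : ∀ u i → NcapD D u (proj₁ (token u i))
      token-∈ u i = step∈N u s , codeDirs-∈ u (choose-∈ zero (codeDirs u) i (codeDirs-nonempty u))
        where
        s : Fin 4
        s = proj₁ (choose zero (codeDirs u) i)

      -- A token determines its vertex: from a label `just s` the vertex is
      -- recovered as back c s; with the label `nothing` both vertices have
      -- N[·] ∩ D = {c}, hence coincide as D is identifying.
      token-determines-vertex : ∀ u u′ i i′ → token u i ≡ token u′ i′ → u ≡ u′
      token-determines-vertex u u′ i i′ eq
        with choose-label zero (codeDirs u) i | choose-label zero (codeDirs u′) i′
      ... | inj₁ l≡a | inj₁ l′≡a′ = begin
          u                ≡⟨ back-step u a ⟨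
          back (step u a) a  ≡⟨ cong₂ back (cong proj₁ eq) a≡a′ ⟩
          back (step u′ a′) a′ ≡⟨ back-step u′ a′ ⟩
          u′               ∎
        where
        open ≡-Reasoning
        a a′ : Fin 4
        a = proj₁ (choose zero (codeDirs u) i)
        a′ = proj₁ (choose zero (codeDirs u′) i′)
        a≡a′ : a ≡ a′
        a≡a′ = just-injective (trans (sym l≡a) (trans (cong proj₂ eq) l′≡a′))
      ... | inj₁ l≡a | inj₂ (l′≡nothing , _) with trans (sym l≡a) (trans (cong proj₂ eq) l′≡nothing)
      ... | ()
      token-determines-vertex u u′ i i′ eq | inj₂ (l≡nothing , _) | inj₁ l′≡a′
        with trans (sym l≡nothing) (trans (cong proj₂ eq) l′≡a′)
      ... | ()
      token-determines-vertex u u′ i i′ eq | inj₂ (_ , only-a) | inj₂ (_ , only-a′) =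
        separates u u′ λ w →
          (λ w∈ → proj₂ (code′ w) (trans (sym c≡c′) (proj₁ (code w) w∈))) ,
          (λ w∈ → proj₂ (code w) (trans c≡c′ (proj₁ (code′ w) w∈)))
        where
        c c′ : V
        c = proj₁ (token u i)
        c′ = proj₁ (token u′ i′)
        code : ∀ w → (NcapD D u w → c ≡ w) × (c ≡ w → NcapD D u w)
        code = singleton-code u _ only-a
        code′ : ∀ w → (NcapD D u′ w → c′ ≡ w) × (c′ ≡ w → NcapD D u′ w)
        code′ = singleton-code u′ _ only-a′
        c≡c′ : c ≡ c′
        c≡c′ = cong proj₁ eq

      token-injective : ∀ {u u′ i i′} → token u i ≡ token u′ i′ → u ≡ u′ × i ≡ i′
      token-injective {u} {u′} {i} {i′} eq with token-determines-vertex u u′ i i′ eq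
      ... | refl = refl , choose-labels-differ zero (codeDirs u) (codeDirs-unique u)
                            (codeDirs-nonempty u) i i′ (cong proj₂ eq)

      labels : List (Maybe (Fin 4))
      labels = nothing ∷ map just (allFin 4)

      ∈-labels : ∀ l → l ∈ labels
      ∈-labels nothing = here refl
      ∈-labels (just s) = there (∈-map⁺ just (∈-allFin s))

      -- The discharging count: the 2|V_g| tokens of the vertices of V_g are
      -- distinct pairs (c , l) with c ∈ D ∩ V_(g+1) and one of 5 labels, so
      -- 2|V_g| ≤ 5|D ∩ V_(g+1)|.
      counting : ∀ v g → ballSize v g ℕ.* 2 ℕ.≤ codeInBall D v (suc g) ℕ.* 5
      counting v g = begin
          length ball ℕ.* length (allFin 2)
        ≡⟨ length-cartesianProductWith token ball (allFin 2) ⟨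
          length tokens
        ≤⟨ unique-⊆⇒length-≤ tokens-unique tokens⊆ ⟩
          length (cartesianProduct codeBall labels)
        ≡⟨ length-cartesianProductWith _,_ codeBall labels ⟩
          length codeBall ℕ.* 5
        ∎
        where
        open ≤-Reasoning
        ball codeBall : List V
        ball = filterᵇ (reach g v) (box v g)
        codeBall = filterᵇ (λ w → reach (suc g) v w ∧ D w) (box v (suc g))
        tokens : List (V × Maybe (Fin 4))
        tokens = cartesianProductWith token ball (allFin 2)
        tokens-unique : Unique tokens
        tokens-unique = Unique.cartesianProductWith⁺ token token-injective
          (Unique.filter⁺ (λ w → T? (reach g v w)) (box-unique v g)) (Unique.allFin⁺ 2)
        token∈codeBall : ∀ u i → T (reach g v u) → proj₁ (token u i) ∈ codeBall
        token∈codeBall u i u∈ball = ∈-filter⁺ (λ w → T? (reach (suc g) v w ∧ D w))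
          (InBox⇒∈box v (suc g) c (reach-box (suc g) v c c-near))
          (Equivalence.from T-∧ (c-near , Equivalence.from T-≡ (proj₂ (token-∈ u i))))
          where
          c : V
          c = proj₁ (token u i)
          c-near : T (reach (suc g) v c)
          c-near = reach-N g v u c u∈ball (proj₁ (token-∈ u i))
        tokens⊆ : ∀ {t} → t ∈ tokens → t ∈ cartesianProduct codeBall labels
        tokens⊆ t∈ with ∈-cartesianProductWith⁻ token ball (allFin 2) t∈
        ... | u , i , u∈ball , _ , refl = ∈-cartesianProduct⁺
              (token∈codeBall u i (proj₂ (∈-filter⁻ (λ w → T? (reach g v w)) u∈ball)))
              (∈-labels (proj₂ (token u i)))

open Growth using (density-from-counting)
open Grid using (ballSize-positive; ballSize-quadratic)
open Tokens using (module Code)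

proposition1 : (D : V → Bool) → IdentifyingCode D → (v : V) → DensityAtLeast2/5 D v
proposition1 D identifying v =
  density-from-counting (ballSize v) (codeInBall D v)
    (Code.counting D identifying v) (ballSize-positive v) (ballSize-quadratic v)
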